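{- Up to $\mathbf{S5}$-provable equivalence, there are exactly $2^{32}=4{,}294{,}967{,}296$ formulas of $\mathcal{L}_\Box$ whose only variable is $x$; that is, the relation $\mathbf{S5}\vdash\varphi\leftrightarrow\psi$ on such formulas has exactly $2^{32}$ equivalence classes.
   Context: $\mathcal{L}_\Box$ is the modal language with a countably infinite set of variables, two one-place predicate symbols $T,F$, and formulas $\varphi::=T(x)\mid F(x)\mid\neg\varphi\mid(\varphi\wedge\varphi)\mid\Box\varphi$ (no quantifiers and no propositional variables); $\vee,\to,\leftrightarrow,\lozenge$ are abbreviations. $\mathbf{S5}$ in this signature is the least set of $\mathcal{L}_\Box$ formulas containing all substitution instances of classical propositional tautologies and all instances of $\Box(A\to B)\to(\Box A\to\Box B)$, $\Box A\to A$, $\lozenge A\to\Box\lozenge A$, closed under modus ponens and necessitation (if $A$ is a theorem so is $\Box A$). Here $T(x)$ and $F(x)$ behave as independent atoms. -}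

module Defs where

open import Data.Nat using (ℕ)
open import Data.Bool using (Bool; true; false; not; _∧_)
open import Relation.Binary.PropositionalEquality using (_≡_)
open import Data.Product using (Σ)

Var : Set
Var = ℕ

data Form : Set where
  T   : Var → Form
  F   : Var → Form
  ¬′_ : Form → Form
  _∧′_ : Form → Form → Form
  □_  : Form → Form

infixr 6 _∧′_
infixr 5 _∨′_
infixr 4 _⇒_ _↔′_

_∨′_ : Form → Form → Form
A ∨′ B = ¬′ (¬′ A ∧′ ¬′ B)

_⇒_ : Form → Form → Form
A ⇒ B = ¬′ (A ∧′ ¬′ B)

_↔′_ : Form → Form → Form
A ↔′ B = (A ⇒ B) ∧′ (B ⇒ A)

◇_ : Form → Form
◇ A = ¬′ (□ (¬′ A))

data PForm : Set where
  atom : ℕ → PForm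
  pneg : PForm → PForm
  pand : PForm → PForm → PForm

evalP : (ℕ → Bool) → PForm → Bool
evalP v (atom n)   = v n
evalP v (pneg p)   = not (evalP v p)
evalP v (pand p q) = evalP v p ∧ evalP v q

Tautology : PForm → Set
Tautology p = (v : ℕ → Bool) → evalP v p ≡ true

substP : (ℕ → Form) → PForm → Form
substP σ (atom n)   = σ n
substP σ (pneg p)   = ¬′ substP σ p
substP σ (pand p q) = substP σ p ∧′ substP σ q

data S5⊢_ : Form → Set where
  taut : (σ : ℕ → Form) (p : PForm) → Tautology p → S5⊢ substP σ p
  axK  : (A B : Form) → S5⊢ (□ (A ⇒ B) ⇒ (□ A ⇒ □ B))
  axT  : (A : Form) → S5⊢ (□ A ⇒ A)
  ax5  : (A : Form) → S5⊢ (◇ A ⇒ □ (◇ A))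
  mp   : {A B : Form} → S5⊢ (A ⇒ B) → S5⊢ A → S5⊢ B
  nec  : {A : Form} → S5⊢ A → S5⊢ (□ A)

data OnlyVar (x : Var) : Form → Set where
  T-x : OnlyVar x (T x)
  F-x : OnlyVar x (F x)
  ¬-x : {A : Form} → OnlyVar x A → OnlyVar x (¬′ A)
  ∧-x : {A B : Form} → OnlyVar x A → OnlyVar x B → OnlyVar x (A ∧′ B)
  □-x : {A : Form} → OnlyVar x A → OnlyVar x (□ A)

Form₁ : Var → Set
Form₁ x = Σ Form (OnlyVar x)

{-# OPTIONS --safe #-}
module Submission where

-- A formula whose only variable is x sees, at a world, the truth values of T(x) and
-- F(x), and through □ the set S ⊆ Bool² of valuations realised anywhere in the
-- (universal) S5 model.  A pointed model is thus a pair (S, w) with w ∈ S: there are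
-- 4 · 2³ = 32 of them.  The characteristic formula χ(S, w) = α w ∧ ⋀_v ±◇ α v (α v
-- describing the valuation v, the sign telling whether v ∈ S) decides every one-variable
-- formula φ: S5 ⊢ χ(S, w) → ±φ according to the truth value of φ at (S, w).  The
-- induction goes through □ because each ±◇ α v implies its own necessitation (by axiom
-- 5, and by 4 for the negative sign).  As the 32 characteristic formulas are provably
-- exhaustive, S5 ⊢ φ ↔ ψ iff φ and ψ have the same truth table on the 32 pointed
-- models; by soundness, and since every truth table is realised by a Boolean combination
-- of T(x), F(x) and the ◇ α v, the equivalence classes correspond to the 2^32 Boolean
-- functions on 32 points.

open import Defs
open import Data.Nat using (ℕ; zero; suc; _^_; _<ᵇ_)
open import Data.Fin using (Fin; zero; suc; combine; quotient; remainder)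
open import Data.Fin.Properties using (combine-remQuot; remQuot-combine)
open import Data.Bool using (Bool; true; false; not; _∧_; _∨_; if_then_else_)
open import Data.Bool.Properties using (∧-conicalˡ; ∧-conicalʳ; ∨-zeroʳ; ∧-identityʳ; not-involutive)
open import Data.Vec using (Vec; []; _∷_; lookup; tabulate; map)
open import Data.Vec.Properties using (lookup∘tabulate; tabulate∘lookup; tabulate-cong; map-cong)
open import Data.Vec.Relation.Unary.All as Vec using ([]; _∷_)
open import Data.List using (List; []; _∷_; length; foldr)
import Data.List as List
open import Data.List.Relation.Unary.All using (All; []; _∷_; universal)
open import Data.List.Relation.Unary.All.Properties using (map⁺)
open import Data.Product using (Σ; proj₁; proj₂; _×_; _,_)
open import Function.Base using (_∘_)
open import Function.Bundles using (_⇔_; mk⇔)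
open import Relation.Binary.PropositionalEquality
  using (_≡_; refl; sym; trans; cong; cong₂; subst; _≗_; module ≡-Reasoning)

open ≡-Reasoning

-- Numbering Boolean functions

bit : Bool → Fin 2
bit false = zero
bit true  = suc zero

fromBit : Fin 2 → Bool
fromBit zero       = false
fromBit (suc zero) = true

bit-fromBit : ∀ i → bit (fromBit i) ≡ i
bit-fromBit zero       = refl
bit-fromBit (suc zero) = refl

fromBit-bit : ∀ b → fromBit (bit b) ≡ b
fromBit-bit false = refl
fromBit-bit true  = refl

vecToFin : ∀ {k} → Vec Bool k → Fin (2 ^ k)
vecToFin []       = zero
vecToFin (b ∷ bs) = combine (bit b) (vecToFin bs)

finToVec : ∀ k → Fin (2 ^ k) → Vec Bool k
finToVec zero    _ = []
finToVec (suc k) i = fromBit (quotient {2} (2 ^ k) i) ∷ finToVec k (remainder {2} (2 ^ k) i)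

vecToFin-finToVec : ∀ k i → vecToFin (finToVec k i) ≡ i
vecToFin-finToVec zero    zero = refl
vecToFin-finToVec (suc k) i    = begin
  combine (bit (fromBit (quotient {2} (2 ^ k) i))) (vecToFin (finToVec k (remainder {2} (2 ^ k) i)))
    ≡⟨ cong₂ combine (bit-fromBit (quotient {2} (2 ^ k) i))
                     (vecToFin-finToVec k (remainder {2} (2 ^ k) i)) ⟩
  combine (quotient {2} (2 ^ k) i) (remainder {2} (2 ^ k) i)
    ≡⟨ combine-remQuot {2} (2 ^ k) i ⟩
  i ∎

finToVec-vecToFin : ∀ {k} (bs : Vec Bool k) → finToVec k (vecToFin bs) ≡ bs
finToVec-vecToFin []               = refl
finToVec-vecToFin {suc k} (b ∷ bs) = cong₂ _∷_
  (trans (cong (fromBit ∘ proj₁) split) (fromBit-bit b))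
  (trans (cong (finToVec k ∘ proj₂) split) (finToVec-vecToFin bs))
  where split = remQuot-combine {2} {2 ^ k} (bit b) (vecToFin bs)

encodeFun : ∀ {n} → (Vec Bool n → Bool) → Fin (2 ^ 2 ^ n)
encodeFun {n} f = vecToFin (tabulate (f ∘ finToVec n))

decodeFun : ∀ {n} → Fin (2 ^ 2 ^ n) → Vec Bool n → Bool
decodeFun {n} k bs = lookup (finToVec (2 ^ n) k) (vecToFin bs)

encodeFun-cong : ∀ {n} {f g : Vec Bool n → Bool} → f ≗ g → encodeFun f ≡ encodeFun g
encodeFun-cong {n} f≗g = cong vecToFin (tabulate-cong (f≗g ∘ finToVec n))

encodeFun-injective : ∀ {n} {f g : Vec Bool n → Bool} → encodeFun f ≡ encodeFun g → f ≗ g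
encodeFun-injective {n} {f} {g} eq bs = begin
  f bs                              ≡⟨ cong f (finToVec-vecToFin bs) ⟨
  f (finToVec n (vecToFin bs))      ≡⟨ lookup∘tabulate (f ∘ finToVec n) (vecToFin bs) ⟨
  lookup (tabulate (f ∘ finToVec n)) (vecToFin bs)
    ≡⟨ cong (λ t → lookup t (vecToFin bs)) tables ⟩
  lookup (tabulate (g ∘ finToVec n)) (vecToFin bs)
    ≡⟨ lookup∘tabulate (g ∘ finToVec n) (vecToFin bs) ⟩
  g (finToVec n (vecToFin bs))      ≡⟨ cong g (finToVec-vecToFin bs) ⟩
  g bs ∎
  where
  tables : tabulate (f ∘ finToVec n) ≡ tabulate (g ∘ finToVec n)
  tables = trans (sym (finToVec-vecToFin _)) (trans (cong (finToVec (2 ^ n)) eq) (finToVec-vecToFin _))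

encodeFun-decodeFun : ∀ {n} (k : Fin (2 ^ 2 ^ n)) → encodeFun (decodeFun {n} k) ≡ k
encodeFun-decodeFun {n} k = begin
  vecToFin (tabulate (λ i → lookup table (vecToFin (finToVec n i))))
    ≡⟨ cong vecToFin (tabulate-cong (cong (lookup table) ∘ vecToFin-finToVec n)) ⟩
  vecToFin (tabulate (lookup table)) ≡⟨ cong vecToFin (tabulate∘lookup table) ⟩
  vecToFin table                     ≡⟨ vecToFin-finToVec (2 ^ n) k ⟩
  k ∎
  where table = finToVec (2 ^ n) k

-- Propositional tautologies

valuation : ∀ {k} → Vec Bool k → ℕ → Bool
valuation []       _       = false
valuation (b ∷ bs) zero    = b
valuation (b ∷ bs) (suc n) = valuation bs n

prefix : ∀ k → (ℕ → Bool) → Vec Bool k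
prefix zero    v = []
prefix (suc k) v = v 0 ∷ prefix k (v ∘ suc)

valuation-prefix : ∀ k v n → (n <ᵇ k) ≡ true → valuation (prefix k v) n ≡ v n
valuation-prefix (suc k) v zero    _   = refl
valuation-prefix (suc k) v (suc n) n<k = valuation-prefix k (v ∘ suc) n n<k

atomsBelow : ℕ → PForm → Bool
atomsBelow k (atom n)   = n <ᵇ k
atomsBelow k (pneg P)   = atomsBelow k P
atomsBelow k (pand P Q) = atomsBelow k P ∧ atomsBelow k Q

evalP-local : ∀ k P {v w : ℕ → Bool} → atomsBelow k P ≡ true →
              (∀ n → (n <ᵇ k) ≡ true → v n ≡ w n) → evalP v P ≡ evalP w P
evalP-local k (atom n)   below v≈w = v≈w n below
evalP-local k (pneg P)   below v≈w = cong not (evalP-local k P below v≈w)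
evalP-local k (pand P Q) below v≈w = cong₂ _∧_
  (evalP-local k P (∧-conicalˡ _ _ below) v≈w)
  (evalP-local k Q (∧-conicalʳ (atomsBelow k P) _ below) v≈w)

allVecᵇ : ∀ k → (Vec Bool k → Bool) → Bool
allVecᵇ zero    f = f []
allVecᵇ (suc k) f = allVecᵇ k (f ∘ (true ∷_)) ∧ allVecᵇ k (f ∘ (false ∷_))

allVecᵇ-sound : ∀ k f → allVecᵇ k f ≡ true → ∀ bs → f bs ≡ true
allVecᵇ-sound zero    f all []           = all
allVecᵇ-sound (suc k) f all (true ∷ bs)  = allVecᵇ-sound k _ (∧-conicalˡ _ _ all) bs
allVecᵇ-sound (suc k) f all (false ∷ bs) =
  allVecᵇ-sound k _ (∧-conicalʳ (allVecᵇ k (f ∘ (true ∷_))) _ all) bs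

tautologyᵇ : ℕ → PForm → Bool
tautologyᵇ k P = atomsBelow k P ∧ allVecᵇ k (λ bs → evalP (valuation bs) P)

tautologyᵇ-sound : ∀ k P → tautologyᵇ k P ≡ true → Tautology P
tautologyᵇ-sound k P check v = begin
  evalP v P
    ≡⟨ evalP-local k P (∧-conicalˡ _ _ check) (λ n n<k → sym (valuation-prefix k v n n<k)) ⟩
  evalP (valuation (prefix k v)) P
    ≡⟨ allVecᵇ-sound k _ (∧-conicalʳ (atomsBelow k P) _ check) (prefix k v) ⟩
  true ∎

infixr 6 _&_
infixr 4 _⇛_

_&_ : PForm → PForm → PForm
_&_ = pand

~ : PForm → PForm
~ = pneg

_⇛_ : PForm → PForm → PForm
P ⇛ Q = pneg (pand P (pneg Q))

a0 a1 a2 a3 a4 a5 a6 : PForm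
a0 = atom 0
a1 = atom 1
a2 = atom 2
a3 = atom 3
a4 = atom 4
a5 = atom 5
a6 = atom 6

-- Atom n stands for the n-th formula of the list; the default T 0 is never reached,
-- since tautologyᵇ also checks that every atom is below the length of the list.
atomsAs : List Form → ℕ → Form
atomsAs []       _       = T 0
atomsAs (A ∷ As) zero    = A
atomsAs (A ∷ As) (suc n) = atomsAs As n

tautology : ∀ As hs c → tautologyᵇ (length As) (foldr _⇛_ c hs) ≡ true →
            All (λ h → S5⊢ substP (atomsAs As) h) hs → S5⊢ substP (atomsAs As) c
tautology As hs c check =
  mp-all hs (taut (atomsAs As) (foldr _⇛_ c hs) (tautologyᵇ-sound (length As) (foldr _⇛_ c hs) check))
  where
  mp-all : ∀ hs → S5⊢ substP (atomsAs As) (foldr _⇛_ c hs) →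
           All (λ h → S5⊢ substP (atomsAs As) h) hs → S5⊢ substP (atomsAs As) c
  mp-all []       ⊢c    []          = ⊢c
  mp-all (h ∷ hs) ⊢h⇒c (⊢h ∷ ⊢hs) = mp-all hs (mp ⊢h⇒c ⊢h) ⊢hs

-- Derived rules of S5

⇒-trans : ∀ {A B C} → S5⊢ (A ⇒ B) → S5⊢ (B ⇒ C) → S5⊢ (A ⇒ C)
⇒-trans {A} {B} {C} A⇒B B⇒C =
  tautology (A ∷ B ∷ C ∷ []) ((a0 ⇛ a1) ∷ (a1 ⇛ a2) ∷ []) (a0 ⇛ a2) refl (A⇒B ∷ B⇒C ∷ [])

contraposition : ∀ {A B} → S5⊢ (A ⇒ B) → S5⊢ (¬′ B ⇒ ¬′ A)
contraposition {A} {B} A⇒B =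
  tautology (A ∷ B ∷ []) ((a0 ⇛ a1) ∷ []) (~ a1 ⇛ ~ a0) refl (A⇒B ∷ [])

¬¬-intro : ∀ {A} → S5⊢ (A ⇒ ¬′ ¬′ A)
¬¬-intro {A} = tautology (A ∷ []) [] (a0 ⇛ ~ (~ a0)) refl []

¬¬-elim : ∀ {A} → S5⊢ (¬′ ¬′ A ⇒ A)
¬¬-elim {A} = tautology (A ∷ []) [] (~ (~ a0) ⇛ a0) refl []

□-mono : ∀ {A B} → S5⊢ (A ⇒ B) → S5⊢ (□ A ⇒ □ B)
□-mono {A} {B} A⇒B = mp (axK A B) (nec A⇒B)

□-∧ : ∀ A B → S5⊢ (□ A ∧′ □ B ⇒ □ (A ∧′ B))
□-∧ A B = tautology (□ A ∷ □ (B ⇒ A ∧′ B) ∷ □ B ∷ □ (A ∧′ B) ∷ [])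
  ((a0 ⇛ a1) ∷ (a1 ⇛ a2 ⇛ a3) ∷ []) (a0 & a2 ⇛ a3) refl
  (□-mono (tautology (A ∷ B ∷ []) [] (a0 ⇛ a1 ⇛ a0 & a1) refl []) ∷ axK B (A ∧′ B) ∷ [])

⇒◇ : ∀ A → S5⊢ (A ⇒ ◇ A)
⇒◇ A = ⇒-trans ¬¬-intro (contraposition (axT (¬′ A)))

◇-∧-□ : ∀ A B → S5⊢ (◇ A ∧′ □ B ⇒ ◇ (A ∧′ B))
◇-∧-□ A B = tautology (□ ¬′ A ∷ □ B ∷ □ (¬′ (A ∧′ B) ⇒ ¬′ A) ∷ □ ¬′ (A ∧′ B) ∷ [])
  ((a1 ⇛ a2) ∷ (a2 ⇛ a3 ⇛ a0) ∷ []) (~ a0 & a1 ⇛ ~ a3) refl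
  (□-mono (tautology (A ∷ B ∷ []) [] (a1 ⇛ ~ (a0 & a1) ⇛ ~ a0) refl []) ∷
   axK (¬′ (A ∧′ B)) (¬′ A) ∷ [])

◇-refutes-□ : ∀ {A B} → S5⊢ (A ⇒ ¬′ B) → S5⊢ (◇ A ⇒ ¬′ □ B)
◇-refutes-□ A⇒¬B = contraposition (□-mono (⇒-trans ¬¬-intro (contraposition A⇒¬B)))

Stable : Form → Set
Stable A = S5⊢ (A ⇒ □ A)

¬□-stable : ∀ B → Stable (¬′ □ B)
¬□-stable B = tautology (□ B ∷ □ ¬′ ¬′ B ∷ □ ¬′ □ ¬′ ¬′ B ∷ □ ¬′ □ B ∷ [])
  ((a1 ⇛ a0) ∷ (~ a1 ⇛ a2) ∷ (a2 ⇛ a3) ∷ []) (~ a0 ⇛ a3) refl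
  (□-mono ¬¬-elim ∷ ax5 (¬′ B) ∷ □-mono (contraposition (□-mono ¬¬-intro)) ∷ [])

□-stable : ∀ B → Stable (□ B)
□-stable B = ⇒-trans (⇒◇ (□ B)) (⇒-trans (ax5 (□ B)) (□-mono ◇□⇒□))
  where
  ◇□⇒□ : S5⊢ (◇ □ B ⇒ □ B)
  ◇□⇒□ = ⇒-trans (contraposition (¬□-stable B)) ¬¬-elim

¬◇-stable : ∀ A → Stable (¬′ ◇ A)
¬◇-stable A = ⇒-trans ¬¬-elim (⇒-trans (□-stable (¬′ A)) (□-mono ¬¬-intro))

∧-stable : ∀ {A B} → Stable A → Stable B → Stable (A ∧′ B)
∧-stable {A} {B} A⇒□A B⇒□B = tautology (A ∷ B ∷ □ A ∷ □ B ∷ □ (A ∧′ B) ∷ [])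
  ((a0 ⇛ a2) ∷ (a1 ⇛ a3) ∷ (a2 & a3 ⇛ a4) ∷ []) (a0 & a1 ⇛ a4) refl
  (A⇒□A ∷ B⇒□B ∷ □-∧ A B ∷ [])

lit : Bool → Form → Form
lit true  A = A
lit false A = ¬′ A

lit-◇-stable : ∀ b A → Stable (lit b (◇ A))
lit-◇-stable true  A = ax5 A
lit-◇-stable false A = ¬◇-stable A

lit-¬ : ∀ {X A} b → S5⊢ (X ⇒ lit b A) → S5⊢ (X ⇒ lit (not b) (¬′ A))
lit-¬ {X} {A} true  X⇒A  = ⇒-trans X⇒A ¬¬-intro
lit-¬         false X⇒¬A = X⇒¬A

lit-∧ : ∀ {X A B} b c → S5⊢ (X ⇒ lit b A) → S5⊢ (X ⇒ lit c B) → S5⊢ (X ⇒ lit (b ∧ c) (A ∧′ B))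
lit-∧ {X} {A} {B} true true X⇒A X⇒B = tautology (X ∷ A ∷ B ∷ [])
  ((a0 ⇛ a1) ∷ (a0 ⇛ a2) ∷ []) (a0 ⇛ a1 & a2) refl (X⇒A ∷ X⇒B ∷ [])
lit-∧ {X} {A} {B} true false _ X⇒¬B = tautology (X ∷ A ∷ B ∷ [])
  ((a0 ⇛ ~ a2) ∷ []) (a0 ⇛ ~ (a1 & a2)) refl (X⇒¬B ∷ [])
lit-∧ {X} {A} {B} false c X⇒¬A _ = tautology (X ∷ A ∷ B ∷ [])
  ((a0 ⇛ ~ a1) ∷ []) (a0 ⇛ ~ (a1 & a2)) refl (X⇒¬A ∷ [])

lit-↔ : ∀ {X A B} b c → b ≡ c → S5⊢ (X ⇒ lit b A) → S5⊢ (X ⇒ lit c B) → S5⊢ (X ⇒ (A ↔′ B))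
lit-↔ {X} {A} {B} true .true refl X⇒A X⇒B = tautology (X ∷ A ∷ B ∷ [])
  ((a0 ⇛ a1) ∷ (a0 ⇛ a2) ∷ []) (a0 ⇛ (a1 ⇛ a2) & (a2 ⇛ a1)) refl (X⇒A ∷ X⇒B ∷ [])
lit-↔ {X} {A} {B} false .false refl X⇒¬A X⇒¬B = tautology (X ∷ A ∷ B ∷ [])
  ((a0 ⇛ ~ a1) ∷ (a0 ⇛ ~ a2) ∷ []) (a0 ⇛ (a1 ⇛ a2) & (a2 ⇛ a1)) refl (X⇒¬A ∷ X⇒¬B ∷ [])

-- One-variable Kripke semantics

World : Set
World = Bool × Bool

Cluster : Set
Cluster = World → Bool

worlds : Vec World 4
worlds = (true , true) ∷ (true , false) ∷ (false , true) ∷ (false , false) ∷ []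

every : (World → Bool) → Bool
every f = f (true , true) ∧ (f (true , false) ∧ (f (false , true) ∧ f (false , false)))

every-elim : ∀ {f} → every f ≡ true → ∀ v → f v ≡ true
every-elim {f} all (true , true)   = ∧-conicalˡ _ _ all
every-elim {f} all (true , false)  = ∧-conicalˡ _ _ (∧-conicalʳ (f (true , true)) _ all)
every-elim {f} all (false , true)  = ∧-conicalˡ _ _ (∧-conicalʳ (f (true , false)) _
                                       (∧-conicalʳ (f (true , true)) _ all))
every-elim {f} all (false , false) = ∧-conicalʳ (f (false , true)) _ (∧-conicalʳ (f (true , false)) _
                                       (∧-conicalʳ (f (true , true)) _ all))

every-intro : ∀ {f} → (∀ v → f v ≡ true) → every f ≡ true
every-intro all
  rewrite all (true , true) | all (true , false) | all (false , true) | all (false , false) = refl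

every-false : ∀ {f} → every f ≡ false → Σ World λ v → f v ≡ false
every-false {f} none
  with f (true , true) in e₁ | f (true , false) in e₂ | f (false , true) in e₃ | f (false , false) in e₄
... | false | _     | _     | _     = (true , true) , e₁
... | true  | false | _     | _     = (true , false) , e₂
... | true  | true  | false | _     = (false , true) , e₃
... | true  | true  | true  | false = (false , false) , e₄

∨-if : ∀ c a b → not (not (c ∧ a) ∧ not (not c ∧ b)) ≡ (if c then a else b)
∨-if true  true  _     = refl
∨-if true  false _     = refl
∨-if false _     true  = refl
∨-if false _     false = refl

⇒ᵇ-intro : ∀ {x y} → (x ≡ true → y ≡ true) → not (x ∧ not y) ≡ true
⇒ᵇ-intro {true}  x⇒y rewrite x⇒y refl = refl
⇒ᵇ-intro {false} _   = refl

⇒ᵇ-elim : ∀ {x y} → not (x ∧ not y) ≡ true → x ≡ true → y ≡ true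
⇒ᵇ-elim {true} {true} _ _ = refl

¬¬∧true : ∀ s → not (not s ∧ true) ≡ s
¬¬∧true s = trans (cong not (∧-identityʳ (not s))) (not-involutive s)

-- Every variable is read as the same one; since this is still an S5 model, soundness
-- holds for all formulas.
⟦_⟧ : Form → Cluster → World → Bool
⟦ T _ ⟧    S w = proj₁ w
⟦ F _ ⟧    S w = proj₂ w
⟦ ¬′ A ⟧   S w = not (⟦ A ⟧ S w)
⟦ A ∧′ B ⟧ S w = ⟦ A ⟧ S w ∧ ⟦ B ⟧ S w
⟦ □ A ⟧    S w = every (λ v → ⟦ A ⟧ S v ∨ not (S v))

⟦□⟧-elim : ∀ A S w v → ⟦ □ A ⟧ S w ≡ true → S v ≡ true → ⟦ A ⟧ S v ≡ true
⟦□⟧-elim A S w v □A Sv = elim (every-elim {λ u → ⟦ A ⟧ S u ∨ not (S u)} □A v) Sv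
  where
  elim : ∀ {b s} → b ∨ not s ≡ true → s ≡ true → b ≡ true
  elim {true}  _  _    = refl
  elim {false} () refl

⟦□⟧-intro : ∀ A S w → (∀ v → S v ≡ true → ⟦ A ⟧ S v ≡ true) → ⟦ □ A ⟧ S w ≡ true
⟦□⟧-intro A S w all = every-intro λ v → intro (S v) (all v)
  where
  intro : ∀ {b} s → (s ≡ true → b ≡ true) → b ∨ not s ≡ true
  intro         true  b = subst (λ b → b ∨ false ≡ true) (sym (b refl)) refl
  intro {b = b} false _ = ∨-zeroʳ b

⟦□⟧-false : ∀ A S w → ⟦ □ A ⟧ S w ≡ false → Σ World λ v → S v ≡ true × ⟦ A ⟧ S v ≡ false
⟦□⟧-false A S w □A with every-false {λ u → ⟦ A ⟧ S u ∨ not (S u)} □A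
... | v , Av∨v∉S = v , counterexample Av∨v∉S
  where
  counterexample : ∀ {b s} → b ∨ not s ≡ false → s ≡ true × b ≡ false
  counterexample {false} {true} _ = refl , refl

⟦substP⟧ : ∀ σ P {S w} → ⟦ substP σ P ⟧ S w ≡ evalP (λ n → ⟦ σ n ⟧ S w) P
⟦substP⟧ σ (atom n)   = refl
⟦substP⟧ σ (pneg P)   = cong not (⟦substP⟧ σ P)
⟦substP⟧ σ (pand P Q) = cong₂ _∧_ (⟦substP⟧ σ P) (⟦substP⟧ σ Q)

sound : ∀ {A} → S5⊢ A → ∀ S w → S w ≡ true → ⟦ A ⟧ S w ≡ true
sound (taut σ P valid) S w _  = trans (⟦substP⟧ σ P) (valid _)
sound (axK A B)       S w _  = ⇒ᵇ-intro λ □A⇒B → ⇒ᵇ-intro λ □A → ⟦□⟧-intro B S w λ v v∈S →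
  ⇒ᵇ-elim (⟦□⟧-elim (A ⇒ B) S w v □A⇒B v∈S) (⟦□⟧-elim A S w v □A v∈S)
sound (axT A)         S w w∈S = ⇒ᵇ-intro λ □A → ⟦□⟧-elim A S w w □A w∈S
sound (ax5 A)         S w _  = ⇒ᵇ-intro λ ◇A → ⟦□⟧-intro (◇ A) S w λ _ _ → ◇A
sound (mp A⇒B ⊢A)     S w w∈S = ⇒ᵇ-elim (sound A⇒B S w w∈S) (sound ⊢A S w w∈S)
sound (nec {A} ⊢A)    S w _  = ⟦□⟧-intro A S w λ v v∈S → sound ⊢A S v v∈S

-- Five bits code a pointed model: the actual world (a , b), followed by the membership
-- of the other three worlds in the order of `worlds`.
world : Vec Bool 5 → World
world (a ∷ b ∷ _) = a , b

table : Bool → Bool → Bool → Bool → Cluster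
table s _ _ _ (true , true)   = s
table _ s _ _ (true , false)  = s
table _ _ s _ (false , true)  = s
table _ _ _ s (false , false) = s

cluster : Vec Bool 5 → Cluster
cluster (true  ∷ true  ∷ s₁ ∷ s₂ ∷ s₃ ∷ []) = table true s₁ s₂ s₃
cluster (true  ∷ false ∷ s₁ ∷ s₂ ∷ s₃ ∷ []) = table s₁ true s₂ s₃
cluster (false ∷ true  ∷ s₁ ∷ s₂ ∷ s₃ ∷ []) = table s₁ s₂ true s₃
cluster (false ∷ false ∷ s₁ ∷ s₂ ∷ s₃ ∷ []) = table s₁ s₂ s₃ true

world∈cluster : ∀ bs → cluster bs (world bs) ≡ true
world∈cluster (true  ∷ true  ∷ _ ∷ _ ∷ _ ∷ []) = refl
world∈cluster (true  ∷ false ∷ _ ∷ _ ∷ _ ∷ []) = refl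
world∈cluster (false ∷ true  ∷ _ ∷ _ ∷ _ ∷ []) = refl
world∈cluster (false ∷ false ∷ _ ∷ _ ∷ _ ∷ []) = refl

truthTable : Form → Vec Bool 5 → Bool
truthTable φ bs = ⟦ φ ⟧ (cluster bs) (world bs)

truthTable-↔ : ∀ {A B} → S5⊢ (A ↔′ B) → truthTable A ≗ truthTable B
truthTable-↔ {A} {B} A↔B bs = agree (sound A↔B (cluster bs) (world bs) (world∈cluster bs))
  where
  agree : ∀ {x y} → not (x ∧ not y) ∧ not (y ∧ not x) ≡ true → x ≡ y
  agree {true}  {true}  _ = refl
  agree {false} {false} _ = refl

profile : Cluster → World → Vec Bool 6
profile S w = proj₁ w ∷ proj₂ w ∷ map S worlds

fromProfile : Vec Bool 6 → Vec Bool 5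
fromProfile (true  ∷ true  ∷ _  ∷ s₁ ∷ s₂ ∷ s₃ ∷ []) = true  ∷ true  ∷ s₁ ∷ s₂ ∷ s₃ ∷ []
fromProfile (true  ∷ false ∷ s₁ ∷ _  ∷ s₂ ∷ s₃ ∷ []) = true  ∷ false ∷ s₁ ∷ s₂ ∷ s₃ ∷ []
fromProfile (false ∷ true  ∷ s₁ ∷ s₂ ∷ _  ∷ s₃ ∷ []) = false ∷ true  ∷ s₁ ∷ s₂ ∷ s₃ ∷ []
fromProfile (false ∷ false ∷ s₁ ∷ s₂ ∷ s₃ ∷ _  ∷ []) = false ∷ false ∷ s₁ ∷ s₂ ∷ s₃ ∷ []

fromProfile-profile : ∀ bs → fromProfile (profile (cluster bs) (world bs)) ≡ bs
fromProfile-profile (true  ∷ true  ∷ _ ∷ _ ∷ _ ∷ []) = refl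
fromProfile-profile (true  ∷ false ∷ _ ∷ _ ∷ _ ∷ []) = refl
fromProfile-profile (false ∷ true  ∷ _ ∷ _ ∷ _ ∷ []) = refl
fromProfile-profile (false ∷ false ∷ _ ∷ _ ∷ _ ∷ []) = refl

allVecs : ∀ k → List (Vec Bool k)
allVecs zero    = [] ∷ []
allVecs (suc k) = List.map (true ∷_) (allVecs k) List.++ List.map (false ∷_) (allVecs k)

-- Characteristic formulas

⋀ : (World → Form) → Form
⋀ G = G (true , true) ∧′ (G (true , false) ∧′ (G (false , true) ∧′ G (false , false)))

conjunctsOf : (World → Form) → List Form
conjunctsOf G = G (true , true) ∷ G (true , false) ∷ G (false , true) ∷ G (false , false) ∷ []

⋀-elim : ∀ G v → S5⊢ (⋀ G ⇒ G v)
⋀-elim G (true , true)   = tautology (conjunctsOf G) [] (a0 & a1 & a2 & a3 ⇛ a0) refl []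
⋀-elim G (true , false)  = tautology (conjunctsOf G) [] (a0 & a1 & a2 & a3 ⇛ a1) refl []
⋀-elim G (false , true)  = tautology (conjunctsOf G) [] (a0 & a1 & a2 & a3 ⇛ a2) refl []
⋀-elim G (false , false) = tautology (conjunctsOf G) [] (a0 & a1 & a2 & a3 ⇛ a3) refl []

⋀-intro : ∀ G → (∀ v → S5⊢ G v) → S5⊢ ⋀ G
⋀-intro G ⊢G = tautology (conjunctsOf G) (a0 ∷ a1 ∷ a2 ∷ a3 ∷ []) (a0 & a1 & a2 & a3) refl
  (⊢G (true , true) ∷ ⊢G (true , false) ∷ ⊢G (false , true) ∷ ⊢G (false , false) ∷ [])

⋀-stable : ∀ G → (∀ v → Stable (G v)) → Stable (⋀ G)
⋀-stable G stable = ∧-stable (stable (true , true)) (∧-stable (stable (true , false))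
  (∧-stable (stable (false , true)) (stable (false , false))))

module OneVariable (x : Var) where

  p q : Form
  p = T x
  q = F x

  α : World → Form
  α w = lit (proj₁ w) p ∧′ lit (proj₂ w) q

  D : Cluster → Form
  D S = ⋀ (λ v → lit (S v) (◇ α v))

  χ : Cluster → World → Form
  χ S w = α w ∧′ D S

  D-stable : ∀ S → Stable (D S)
  D-stable S = ⋀-stable _ (λ v → lit-◇-stable (S v) (α v))

  D-lit : ∀ S v → S5⊢ (D S ⇒ lit (S v) (◇ α v))
  D-lit S = ⋀-elim (λ v → lit (S v) (◇ α v))

  D⇒◇α : ∀ S v → S v ≡ true → S5⊢ (D S ⇒ ◇ α v)
  D⇒◇α S v v∈S = subst (λ b → S5⊢ (D S ⇒ lit b (◇ α v))) v∈S (D-lit S v)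

  D⇒¬◇α : ∀ S v → S v ≡ false → S5⊢ (D S ⇒ ¬′ ◇ α v)
  D⇒¬◇α S v v∉S = subst (λ b → S5⊢ (D S ⇒ lit b (◇ α v))) v∉S (D-lit S v)

  χ⇒D : ∀ S w → S5⊢ (χ S w ⇒ D S)
  χ⇒D S w = tautology (α w ∷ D S ∷ []) [] (a0 & a1 ⇛ a1) refl []

  by-worlds : ∀ {A B} → (∀ v → S5⊢ (α v ∧′ A ⇒ B)) → S5⊢ (A ⇒ B)
  by-worlds {A} {B} cases = tautology (p ∷ q ∷ A ∷ B ∷ [])
    (((a0 & a1) & a2 ⇛ a3) ∷ ((a0 & ~ a1) & a2 ⇛ a3) ∷
     ((~ a0 & a1) & a2 ⇛ a3) ∷ ((~ a0 & ~ a1) & a2 ⇛ a3) ∷ [])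
    (a2 ⇛ a3) refl
    (cases (true , true) ∷ cases (true , false) ∷ cases (false , true) ∷ cases (false , false) ∷ [])

  D⇒□ : ∀ S ψ → (∀ v → S v ≡ true → S5⊢ (χ S v ⇒ ψ)) → S5⊢ (D S ⇒ □ ψ)
  D⇒□ S ψ χ⇒ψ = ⇒-trans (D-stable S) (□-mono (by-worlds case))
    where
    case : ∀ v → S5⊢ (α v ∧′ D S ⇒ ψ)
    case v with S v in Sv
    ... | true  = χ⇒ψ v Sv
    ... | false = tautology (α v ∷ D S ∷ ψ ∷ ◇ α v ∷ [])
      ((a1 ⇛ ~ a3) ∷ (a0 ⇛ a3) ∷ []) (a0 & a1 ⇛ a2) refl (D⇒¬◇α S v Sv ∷ ⇒◇ (α v) ∷ [])

  D⇒¬□ : ∀ S ψ v → S v ≡ true → S5⊢ (χ S v ⇒ ¬′ ψ) → S5⊢ (D S ⇒ ¬′ □ ψ)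
  D⇒¬□ S ψ v v∈S χ⇒¬ψ = tautology (D S ∷ ◇ α v ∷ □ D S ∷ ◇ χ S v ∷ □ ψ ∷ [])
    ((a0 ⇛ a1) ∷ (a0 ⇛ a2) ∷ (a1 & a2 ⇛ a3) ∷ (a3 ⇛ ~ a4) ∷ []) (a0 ⇛ ~ a4) refl
    (D⇒◇α S v v∈S ∷ D-stable S ∷ ◇-∧-□ (α v) (D S) ∷ ◇-refutes-□ χ⇒¬ψ ∷ [])

  truth-□ : ∀ S ψ → (∀ v → S5⊢ (χ S v ⇒ lit (⟦ ψ ⟧ S v) ψ)) →
            ∀ w → S5⊢ (χ S w ⇒ lit (⟦ □ ψ ⟧ S w) (□ ψ))
  truth-□ S ψ IH w with ⟦ □ ψ ⟧ S w in □ψ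
  ... | true  = ⇒-trans (χ⇒D S w) (D⇒□ S ψ λ v v∈S →
    subst (λ b → S5⊢ (χ S v ⇒ lit b ψ)) (⟦□⟧-elim ψ S w v □ψ v∈S) (IH v))
  ... | false with ⟦□⟧-false ψ S w □ψ
  ...   | v , v∈S , ¬ψ = ⇒-trans (χ⇒D S w) (D⇒¬□ S ψ v v∈S
    (subst (λ b → S5⊢ (χ S v ⇒ lit b ψ)) ¬ψ (IH v)))

  truth-lemma : ∀ {φ} → OnlyVar x φ → ∀ S w → S5⊢ (χ S w ⇒ lit (⟦ φ ⟧ S w) φ)
  truth-lemma T-x S w = tautology (lit (proj₁ w) p ∷ lit (proj₂ w) q ∷ D S ∷ []) []
    ((a0 & a1) & a2 ⇛ a0) refl []
  truth-lemma F-x S w = tautology (lit (proj₁ w) p ∷ lit (proj₂ w) q ∷ D S ∷ []) []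
    ((a0 & a1) & a2 ⇛ a1) refl []
  truth-lemma (¬-x {φ} o) S w = lit-¬ (⟦ φ ⟧ S w) (truth-lemma o S w)
  truth-lemma (∧-x {φ} {ψ} o₁ o₂) S w =
    lit-∧ (⟦ φ ⟧ S w) (⟦ ψ ⟧ S w) (truth-lemma o₁ S w) (truth-lemma o₂ S w)
  truth-lemma (□-x {φ} o) S w = truth-□ S φ (λ v → truth-lemma o S v) w

  litᴾ : Bool → PForm → PForm
  litᴾ true  P = P
  litᴾ false P = pneg P

  -- χ S w and the reflexivity formula ⋀ (λ v → α v ⇒ ◇ α v) with p, q, ◇ α v abstracted
  -- to the atoms a0, a1 and a2 … a5 (in the order of `worlds`).
  χᴾ : Cluster → World → PForm
  χᴾ S w = (litᴾ (proj₁ w) a0 & litᴾ (proj₂ w) a1) &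
    litᴾ (S (true , true)) a2 & litᴾ (S (true , false)) a3 &
    litᴾ (S (false , true)) a4 & litᴾ (S (false , false)) a5

  reflexiveᴾ : PForm
  reflexiveᴾ = (a0 & a1 ⇛ a2) & (a0 & ~ a1 ⇛ a3) & (~ a0 & a1 ⇛ a4) & (~ a0 & ~ a1 ⇛ a5)

  χ-atoms : Form → List Form
  χ-atoms G = p ∷ q ∷ ◇ α (true , true) ∷ ◇ α (true , false) ∷
              ◇ α (false , true) ∷ ◇ α (false , false) ∷ G ∷ []

  substP-χᴾ : ∀ G S w → substP (atomsAs (χ-atoms G)) (χᴾ S w) ≡ χ S w
  substP-χᴾ G S w =
    cong₂ _∧′_ (cong₂ _∧′_ (lit-atom (proj₁ w) 0) (lit-atom (proj₂ w) 1))
      (cong₂ _∧′_ (lit-atom (S (true , true)) 2) (cong₂ _∧′_ (lit-atom (S (true , false)) 3)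
        (cong₂ _∧′_ (lit-atom (S (false , true)) 4) (lit-atom (S (false , false)) 5))))
    where
    lit-atom : ∀ b n → substP (atomsAs (χ-atoms G)) (litᴾ b (atom n)) ≡ lit b (atomsAs (χ-atoms G) n)
    lit-atom true  n = refl
    lit-atom false n = refl

  -- The 32 characteristic formulas are exhaustive: at any propositional valuation of
  -- p, q and the ◇ α v, reflexivity puts the actual world into the cluster described.
  exhaustive : ∀ G → (∀ bs → S5⊢ (χ (cluster bs) (world bs) ⇒ G)) → S5⊢ G
  exhaustive G χ⇒G = tautology (χ-atoms G)
    (reflexiveᴾ ∷ List.map χᴾ⇛a6 (allVecs 5)) a6 refl
    (⋀-intro _ (λ v → ⇒◇ (α v)) ∷ map⁺ {f = χᴾ⇛a6} (universal χᴾ⇒G (allVecs 5)))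
    where
    χᴾ⇛a6 : Vec Bool 5 → PForm
    χᴾ⇛a6 bs = χᴾ (cluster bs) (world bs) ⇛ a6

    χᴾ⇒G : ∀ bs → S5⊢ substP (atomsAs (χ-atoms G)) (χᴾ⇛a6 bs)
    χᴾ⇒G bs = subst (λ A → S5⊢ (A ⇒ G)) (sym (substP-χᴾ G (cluster bs) (world bs))) (χ⇒G bs)

  complete : ∀ {φ ψ} → OnlyVar x φ → OnlyVar x ψ → truthTable φ ≗ truthTable ψ → S5⊢ (φ ↔′ ψ)
  complete {φ} {ψ} oφ oψ same = exhaustive (φ ↔′ ψ) λ bs →
    lit-↔ (truthTable φ bs) (truthTable ψ bs) (same bs)
      (truth-lemma oφ (cluster bs) (world bs)) (truth-lemma oψ (cluster bs) (world bs))

  ⊤ₓ : Form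
  ⊤ₓ = p ⇒ p

  ⟦⊤ₓ⟧ : ∀ S w → ⟦ ⊤ₓ ⟧ S w ≡ true
  ⟦⊤ₓ⟧ S (true  , _) = refl
  ⟦⊤ₓ⟧ S (false , _) = refl

  shannon : ∀ {n} → Vec Form n → (Vec Bool n → Bool) → Form
  shannon []       f = lit (f []) ⊤ₓ
  shannon (X ∷ Xs) f = (X ∧′ shannon Xs (f ∘ (true ∷_))) ∨′ (¬′ X ∧′ shannon Xs (f ∘ (false ∷_)))

  ⟦shannon⟧ : ∀ {n} (Xs : Vec Form n) f S w → ⟦ shannon Xs f ⟧ S w ≡ f (map (λ X → ⟦ X ⟧ S w) Xs)
  ⟦shannon⟧ [] f S w with f []
  ... | true  = ⟦⊤ₓ⟧ S w
  ... | false = cong not (⟦⊤ₓ⟧ S w)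
  ⟦shannon⟧ (X ∷ Xs) f S w = trans (∨-if (⟦ X ⟧ S w) _ _) (branch (⟦ X ⟧ S w))
    where
    branch : ∀ c → (if c then ⟦ shannon Xs (f ∘ (true ∷_)) ⟧ S w
                             else ⟦ shannon Xs (f ∘ (false ∷_)) ⟧ S w)
                   ≡ f (c ∷ map (λ X → ⟦ X ⟧ S w) Xs)
    branch true  = ⟦shannon⟧ Xs _ S w
    branch false = ⟦shannon⟧ Xs _ S w

  onlyVar-lit : ∀ b {A} → OnlyVar x A → OnlyVar x (lit b A)
  onlyVar-lit true  o = o
  onlyVar-lit false o = ¬-x o

  onlyVar-shannon : ∀ {n} {Xs : Vec Form n} → Vec.All (OnlyVar x) Xs → ∀ f → OnlyVar x (shannon Xs f)
  onlyVar-shannon []       f = onlyVar-lit (f []) (¬-x (∧-x T-x (¬-x T-x)))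
  onlyVar-shannon (o ∷ os) f = ¬-x (∧-x (¬-x (∧-x o (onlyVar-shannon os _)))
                                        (¬-x (∧-x (¬-x o) (onlyVar-shannon os _))))

  basics : Vec Form 6
  basics = p ∷ q ∷ map (λ v → ◇ α v) worlds

  onlyVar-basics : Vec.All (OnlyVar x) basics
  onlyVar-basics = T-x ∷ F-x ∷ ◇α-x ∷ ◇α-x ∷ ◇α-x ∷ ◇α-x ∷ []
    where
    ◇α-x : ∀ {v} → OnlyVar x (◇ α v)
    ◇α-x {v} = ¬-x (□-x (¬-x (∧-x (onlyVar-lit (proj₁ v) T-x) (onlyVar-lit (proj₂ v) F-x))))

  ⟦◇α⟧ : ∀ S w v → ⟦ ◇ α v ⟧ S w ≡ S v
  ⟦◇α⟧ S w (true  , true)  = ¬¬∧true (S (true , true))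
  ⟦◇α⟧ S w (true  , false) = ¬¬∧true (S (true , false))
  ⟦◇α⟧ S w (false , true)  = ¬¬∧true (S (false , true))
  ⟦◇α⟧ S w (false , false) = not-involutive (S (false , false))

  ⟦basics⟧ : ∀ S w → map (λ X → ⟦ X ⟧ S w) basics ≡ profile S w
  ⟦basics⟧ S w = cong (λ ss → proj₁ w ∷ proj₂ w ∷ ss) (map-cong (⟦◇α⟧ S w) worlds)

  realize : (Vec Bool 5 → Bool) → Form
  realize f = shannon basics (f ∘ fromProfile)

  onlyVar-realize : ∀ f → OnlyVar x (realize f)
  onlyVar-realize f = onlyVar-shannon onlyVar-basics (f ∘ fromProfile)

  truthTable-realize : ∀ f → truthTable (realize f) ≗ f
  truthTable-realize f bs = begin
    ⟦ realize f ⟧ (cluster bs) (world bs)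
      ≡⟨ ⟦shannon⟧ basics (f ∘ fromProfile) (cluster bs) (world bs) ⟩
    f (fromProfile (map (λ X → ⟦ X ⟧ (cluster bs) (world bs)) basics))
      ≡⟨ cong (f ∘ fromProfile) (⟦basics⟧ (cluster bs) (world bs)) ⟩
    f (fromProfile (profile (cluster bs) (world bs)))
      ≡⟨ cong f (fromProfile-profile bs) ⟩
    f bs ∎

mainTheorem4 : (x : Var) →
    Σ (Form₁ x → Fin (2 ^ 32)) λ cls →
    ((φ ψ : Form₁ x) → (S5⊢ (proj₁ φ ↔′ proj₁ ψ)) ⇔ (cls φ ≡ cls ψ))
    × ((k : Fin (2 ^ 32)) → Σ (Form₁ x) λ φ → cls φ ≡ k)
mainTheorem4 x = cls , (λ φ ψ → mk⇔ (sound⇒ φ ψ) (complete⇐ φ ψ)) , surjective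
  where
  open OneVariable x

  cls : Form₁ x → Fin (2 ^ 32)
  cls φ = encodeFun (truthTable (proj₁ φ))

  sound⇒ : ∀ φ ψ → S5⊢ (proj₁ φ ↔′ proj₁ ψ) → cls φ ≡ cls ψ
  sound⇒ _ _ φ↔ψ = encodeFun-cong (truthTable-↔ φ↔ψ)

  complete⇐ : ∀ φ ψ → cls φ ≡ cls ψ → S5⊢ (proj₁ φ ↔′ proj₁ ψ)
  complete⇐ (_ , oφ) (_ , oψ) same = complete oφ oψ (encodeFun-injective same)

  surjective : ∀ k → Σ (Form₁ x) λ φ → cls φ ≡ k
  surjective k = (realize (decodeFun k) , onlyVar-realize (decodeFun k)) ,
    trans (encodeFun-cong (truthTable-realize (decodeFun k))) (encodeFun-decodeFun {5} k)
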